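{- Let $k\ge2$, let $G=(V,E)$ be a graph, and let $L$ be a sequence of moves that is valid from an initial configuration $\tau_0\in[k]^V$. Let $H$ be a directed acyclic graph with node set $S(L)$ that is $L$-good and $L$-neighbor-wise independent (with respect to $P_{L,\tau_0}$). Then $\mathrm{rank}(P_{L,\tau_0})\ge|E(H)|$.
   Context: A configuration is $\tau\in[k]^V$. A move is a triple $(v,p,q)$ with $p\ne q\in[k]$, valid for $\tau$ if $\tau(v)=p$. A sequence $L$ has moves $L(t)=(v_t,p_t,q_t)$, $t\in[\ell(L)]$; $S(L)$ is the set of vertices $v_t$. $L$ is valid from $\tau_0$ if each $L(t)$ is valid for $\tau_{t-1}$, where $\tau_t$ is $\tau_{t-1}$ with $v_t$ moved to part $q_t$. $M_{L,\tau_0}\in\{0,\pm1\}^{E\times[\ell(L)]}$: $M[\{a,b\},t]=+1$ if ($a=v_t$, $q_t=\tau_t(b)$) or ($b=v_t$, $q_t=\tau_t(a)$); $-1$ if ($a=v_t$, $p_t=\tau_t(b)$) or ($b=v_t$, $p_t=\tau_t(a)$); $0$ otherwise. A $w$-circuit over $v$ is a set of time steps $t_1<\dots<t_w$ with $v_{t_i}=v$, $q_{t_i}=p_{t_{i+1}}$ ($i<w$), $q_{t_w}=p_{t_1}$; a cycle is an inclusion-wise minimal circuit, $T(C)$ its time steps, $\Gamma(L)$ the set of cycles. $P_{L,\tau_0}[\{a,b\},C]:=\sum_{t\in T(C)}M_{L,\tau_0}[\{a,b\},t]$ for $C\in\Gamma(L)$. For $u,v\in S(L)$, the ordered pair $uv$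 is an $L$-good-arc if there is a cycle $C\in\Gamma(L)$ over $u$ with $P_{L,\tau_0}[\{u,v\},C]\ne0$; a directed graph on a subset of $S(L)$ is $L$-good if all arcs are $L$-good-arcs. A directed graph $H$ with node set $S(L)$ is $L$-neighbor-wise independent if for every $v\in S(L)$, with out-neighbors in $H$ forming a set $U$ of size $m$, there is an ordering $u_1,\dots,u_m$ of $U$ and cycles $C_1,\dots,C_m\in\Gamma(L)$ over $v$ with $P_{L,\tau_0}[\{v,u_i\},C_i]\ne0$ and $P_{L,\tau_0}[\{v,u_j\},C_i]=0$ for all $j\in\{i+1,\dots,m\}$. -}

module Defs where

open import Data.Nat as ℕ using (ℕ; zero; suc; _<?_)
open import Data.Fin as F using (Fin; toℕ; fromℕ<; _≟_) renaming (_<_ to _<ᶠ_)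
open import Data.Integer as ℤ using (ℤ; +_; -[1+_])
open import Data.Rational as ℚ using (ℚ)
open import Data.List using (List; []; _∷_; length)
open import Data.List.Membership.Propositional using (_∈_)
open import Data.List.Relation.Unary.All using (All)
open import Data.List.Relation.Unary.Linked using (Linked)
open import Data.List.Relation.Unary.Unique.Propositional using (Unique)
open import Data.List.Relation.Binary.Subset.Propositional using (_⊆_)
open import Data.Product using (Σ; ∃; ∃-syntax; _×_; _,_; proj₁)
open import Data.Empty using (⊥)
open import Relation.Nullary using (¬_; yes; no)
open import Relation.Binary.PropositionalEquality using (_≡_; _≢_)
open import Relation.Binary.Construct.Closure.Transitive using (TransClosure)
open import Function.Definitions using (Injective)
open import Function.Bundles using (_⇔_)

-- A (finite, simple, undirected) graph on the vertex set V = Fin n.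
-- E is given by a symmetric irreflexive adjacency relation; the edge {a,b}
-- corresponds to Adj a b (equivalently Adj b a).
record Graph (n : ℕ) : Set₁ where
  field
    Adj     : Fin n → Fin n → Set
    symm    : ∀ {a b} → Adj a b → Adj b a
    irrefl  : ∀ {a} → ¬ Adj a a

Config : ℕ → ℕ → Set
Config n k = Fin n → Fin k

record Move (n k : ℕ) : Set where
  constructor move
  field
    vtx : Fin n
    p   : Fin k
    q   : Fin k
    p≢q : p ≢ q
open Move public

-- a sequence of moves L(1..ℓ), indexed here by Fin ℓ (time step t ↦ index t-1)
Seq : ℕ → ℕ → ℕ → Set
Seq n k ℓ = Fin ℓ → Move n k

apply : ∀ {n k} → Move n k → Config n k → Config n k
apply m τ u with u ≟ vtx m
... | yes _ = q m
... | no  _ = τ u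

conf : ∀ {n k ℓ} → Seq n k ℓ → Config n k → ℕ → Config n k
conf {ℓ = ℓ} L τ₀ zero = τ₀
conf {ℓ = ℓ} L τ₀ (suc i) with i <? ℓ
... | yes i<ℓ = apply (L (fromℕ< i<ℓ)) (conf L τ₀ i)
... | no  _   = conf L τ₀ i

before after : ∀ {n k ℓ} → Seq n k ℓ → Config n k → Fin ℓ → Config n k
before L τ₀ t = conf L τ₀ (toℕ t)
after  L τ₀ t = conf L τ₀ (suc (toℕ t))

Valid : ∀ {n k ℓ} → Seq n k ℓ → Config n k → Set
Valid L τ₀ = ∀ t → before L τ₀ t (vtx (L t)) ≡ p (L t)

InS : ∀ {n k ℓ} → Seq n k ℓ → Fin n → Set
InS L v = ∃[ t ] vtx (L t) ≡ v

sgn : ∀ {n k} → Move n k → Fin k → ℤ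
sgn m c with q m ≟ c
... | yes _ = + 1
... | no  _ with p m ≟ c
...   | yes _ = -[1+ 0 ]
...   | no  _ = + 0

Ment : ∀ {n k ℓ} → Seq n k ℓ → Config n k → Fin n → Fin n → Fin ℓ → ℤ
Ment L τ₀ a b t with a ≟ vtx (L t)
... | yes _ = sgn (L t) (after L τ₀ t b)
... | no  _ with b ≟ vtx (L t)
...   | yes _ = sgn (L t) (after L τ₀ t a)
...   | no  _ = + 0

lastOf : ∀ {A : Set} → A → List A → A
lastOf x []       = x
lastOf x (y ∷ ys) = lastOf y ys

-- a circuit over v, given as the increasing list t₁ < … < t_w of its time steps
IsCircuitOver : ∀ {n k ℓ} → Seq n k ℓ → Fin n → List (Fin ℓ) → Set
IsCircuitOver L v []       = ⊥
IsCircuitOver L v (t ∷ ts) =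
  All (λ s → vtx (L s) ≡ v) (t ∷ ts)
  × Linked (λ s s' → (s <ᶠ s') × (q (L s) ≡ p (L s'))) (t ∷ ts)
  × q (L (lastOf t ts)) ≡ p (L t)

IsCircuit : ∀ {n k ℓ} → Seq n k ℓ → List (Fin ℓ) → Set
IsCircuit L ts = ∃[ v ] IsCircuitOver L v ts

IsCycleOver : ∀ {n k ℓ} → Seq n k ℓ → Fin n → List (Fin ℓ) → Set
IsCycleOver L v ts =
  IsCircuitOver L v ts × (∀ ts' → IsCircuit L ts' → ts' ⊆ ts → ts ⊆ ts')

Cycle : ∀ {n k ℓ} → Seq n k ℓ → Set
Cycle {n} L = Σ (List _) λ ts → ∃[ v ] IsCycleOver L v ts

CycleOver : ∀ {n k ℓ} → Seq n k ℓ → Fin n → Set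
CycleOver L v = Σ (List _) λ ts → IsCycleOver L v ts

sumℤ : ∀ {ℓ} → (Fin ℓ → ℤ) → List (Fin ℓ) → ℤ
sumℤ f []       = + 0
sumℤ f (t ∷ ts) = f t ℤ.+ sumℤ f ts

Pent : ∀ {n k ℓ} → Seq n k ℓ → Config n k → Fin n → Fin n → List (Fin ℓ) → ℤ
Pent L τ₀ a b ts = sumℤ (Ment L τ₀ a b) ts

Σℚ : ∀ {m} → (Fin m → ℚ) → ℚ
Σℚ {zero}  f = ℚ.0ℚ
Σℚ {suc m} f = f F.zero ℚ.+ Σℚ (λ i → f (F.suc i))

toℚ : ℤ → ℚ
toℚ z = z ℚ./ 1

-- rank(P_{L,τ₀}) ≥ r over ℚ (= rank over ℝ, P being an integer matrix):
-- there are r columns C₁,…,C_r of P (rows indexed by the edges of G)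
-- that are linearly independent.
RankAtLeast : ∀ {n k ℓ} → Graph n → Seq n k ℓ → Config n k → ℕ → Set
RankAtLeast G L τ₀ r =
  Σ (Fin r → Cycle L) λ C → ((c : Fin r → ℚ) →
     (∀ a b → Graph.Adj G a b →
        Σℚ (λ i → c i ℚ.* toℚ (Pent L τ₀ a b (proj₁ (C i)))) ≡ ℚ.0ℚ) →
     ∀ i → c i ≡ ℚ.0ℚ)

record DiGraph {n k ℓ} (L : Seq n k ℓ) : Set where
  field
    arcs     : List (Fin n × Fin n)
    unique   : Unique arcs
    inNodes  : ∀ {a b} → (a , b) ∈ arcs → InS L a × InS L b

  Arc : Fin n → Fin n → Set
  Arc a b = (a , b) ∈ arcs

  size : ℕ
  size = length arcs
open DiGraph public

Acyclic : ∀ {n k ℓ} {L : Seq n k ℓ} → DiGraph L → Set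
Acyclic {n} H = ∀ (a : Fin n) → ¬ TransClosure (Arc H) a a

-- uv is an L-good-arc. P has rows indexed by E, so P[{u,v},C] only exists
-- for {u,v} ∈ E; we record this explicitly.
GoodArc : ∀ {n k ℓ} → Graph n → Seq n k ℓ → Config n k → Fin n → Fin n → Set
GoodArc G L τ₀ u v =
  InS L u × InS L v × Graph.Adj G u v ×
  Σ (CycleOver L u) λ C → Pent L τ₀ u v (proj₁ C) ≢ + 0

Good : ∀ {n k ℓ} → Graph n → (L : Seq n k ℓ) → Config n k → DiGraph L → Set
Good G L τ₀ H = ∀ {a b} → Arc H a b → GoodArc G L τ₀ a b

-- L-neighbor-wise independent: for every v ∈ S(L) with out-neighbour set U
-- (|U| = m) there is an ordering u₁,…,u_m of U (an injective u : Fin m → Fin n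
-- with image U) and cycles C₁,…,C_m over v with P[{v,uᵢ},Cᵢ] ≠ 0 and
-- P[{v,uⱼ},Cᵢ] = 0 for all j > i.
NeighborWiseIndependent : ∀ {n k ℓ} (L : Seq n k ℓ) → Config n k → DiGraph L → Set
NeighborWiseIndependent {n} L τ₀ H =
  ∀ v → InS L v →
  Σ ℕ λ m → Σ (Fin m → Fin n) λ u → Σ (Fin m → CycleOver L v) λ C →
    Injective _≡_ _≡_ u
    × (∀ b → Arc H v b ⇔ (∃[ i ] u i ≡ b))
    × (∀ i → Pent L τ₀ v (u i) (proj₁ (C i)) ≢ + 0)
    × (∀ i j → i <ᶠ j → Pent L τ₀ v (u j) (proj₁ (C i)) ≡ + 0)

-- Every arc vx of H is assigned a column of P: writing u₁,…,u_m and
-- C₁,…,C_m for the ordering and cycles that neighbor-wise independence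
-- provides at v, the arc v uᵢ gets the cycle Cᵢ, and we record its
-- level m ∸ i.  The pivot of that column is the row {v,x} (an edge of G
-- by goodness), where the entry is nonzero.  Any other column b = wy with
-- a nonzero entry in row {v,x} comes strictly earlier in the order
--   "w is an out-neighbour of v, or w = v and y has a smaller level":
-- a cycle over w only touches rows at w, so w ∈ {v,x}; w = x is an arc
-- vw, and w = v is excluded for larger levels by the triangular zero
-- pattern.  Since H is acyclic on finitely many nodes this order is
-- well-founded, and a matrix whose columns have pivots whose off-pivot
-- entries only meet earlier columns has independent columns (§2).
module Submission where

open import Defs
open import Data.Nat as ℕ using (ℕ; zero; suc; _≤_; _∸_; s≤s)
import Data.Nat.Properties as ℕP
open import Data.Nat.Induction using (<-wellFounded)
open import Data.Fin as F using (Fin; toℕ; _≟_) renaming (_<_ to _<ᶠ_)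
import Data.Fin.Properties as FP
open import Data.Integer as ℤ using (+_)
import Data.Integer.Properties as ℤP
open import Data.Integer.GCD using (gcd)
open import Data.Rational as ℚ using (ℚ; 0ℚ; 1ℚ; _*_; _+_)
import Data.Rational.Properties as ℚP
open import Data.List using (List; []; _∷_; lookup)
open import Data.List.Membership.Propositional.Properties using (∈-lookup)
import Data.List.Membership.DecPropositional as DecMembership
open import Data.List.Relation.Unary.All using (All; []; _∷_) renaming (lookup to All-lookup)
open import Data.List.Relation.Unary.AllPairs using ([]; _∷_)
open import Data.List.Relation.Unary.Unique.Propositional using (Unique)
open import Data.Product using (Σ; ∃; ∃-syntax; _×_; _,_; proj₁; proj₂)
open import Data.Product.Properties using (≡-dec)
open import Data.Product.Relation.Binary.Lex.Strict using (×-Lex; ×-wellFounded)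
open import Data.Sum using (_⊎_; inj₁; inj₂)
open import Data.Empty using (⊥-elim)
open import Function.Base using (flip; _on_)
open import Function.Bundles using (Equivalence)
open import Relation.Nullary using (¬_; yes; no)
open import Level using (0ℓ)
open import Relation.Binary.Core using (Rel)
open import Relation.Binary.Definitions using (Decidable; tri<; tri≈; tri>)
open import Relation.Binary.PropositionalEquality
open import Relation.Binary.Construct.Closure.Transitive using (TransClosure; [_]; _∷_)
import Relation.Binary.Construct.On as On
open import Induction.WellFounded using (WellFounded; Acc; acc)

toℚ-injective-zero : ∀ z → toℚ z ≡ 0ℚ → z ≡ + 0
toℚ-injective-zero z z≡0 = begin
  z                                  ≡⟨ sym (ℚP.↥-/ z 1) ⟩
  ℚ.↥ (toℚ z) ℤ.* gcd z (+ 1)        ≡⟨ cong (λ q → ℚ.↥ q ℤ.* gcd z (+ 1)) z≡0 ⟩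
  + 0 ℤ.* gcd z (+ 1)                ≡⟨ ℤP.*-zeroˡ (gcd z (+ 1)) ⟩
  + 0                                ∎
  where open ≡-Reasoning

*-zero-cancelʳ : ∀ x y → y ≢ 0ℚ → x * y ≡ 0ℚ → x ≡ 0ℚ
*-zero-cancelʳ x y y≢0 xy≡0 = begin
  x                        ≡⟨ sym (ℚP.*-identityʳ x) ⟩
  x * 1ℚ                   ≡⟨ cong (x *_) (sym (ℚP.*-inverseʳ y)) ⟩
  x * (y * ℚ.1/ y)         ≡⟨ sym (ℚP.*-assoc x y (ℚ.1/ y)) ⟩
  (x * y) * ℚ.1/ y         ≡⟨ cong (_* ℚ.1/ y) xy≡0 ⟩
  0ℚ * ℚ.1/ y              ≡⟨ ℚP.*-zeroˡ (ℚ.1/ y) ⟩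
  0ℚ                       ∎
  where
    open ≡-Reasoning
    instance
      y-nonZero : ℚ.NonZero y
      y-nonZero = ℚ.≢-nonZero y≢0

Σℚ-zero : ∀ {m} (f : Fin m → ℚ) → (∀ i → f i ≡ 0ℚ) → Σℚ f ≡ 0ℚ
Σℚ-zero {zero}  f f≡0 = refl
Σℚ-zero {suc m} f f≡0 =
  trans (cong₂ _+_ (f≡0 F.zero) (Σℚ-zero (λ i → f (F.suc i)) (λ i → f≡0 (F.suc i))))
        (ℚP.+-identityˡ 0ℚ)

Σℚ-single : ∀ {m} (f : Fin m → ℚ) r → (∀ i → i ≢ r → f i ≡ 0ℚ) → Σℚ f ≡ f r
Σℚ-single {suc m} f F.zero others =
  trans (cong (λ s → f F.zero + s) (Σℚ-zero (λ i → f (F.suc i)) (λ i → others (F.suc i) (λ ()))))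
        (ℚP.+-identityʳ (f F.zero))
Σℚ-single {suc m} f (F.suc r) others =
  trans (cong (_+ Σℚ (λ i → f (F.suc i))) (others F.zero (λ ())))
        (trans (ℚP.+-identityˡ _)
               (Σℚ-single (λ i → f (F.suc i)) r
                          (λ i i≢r → others (F.suc i) (λ e → i≢r (FP.suc-injective e)))))

-- §2  Triangular independence.  Columns 1..r of a ℚ-matrix M (rows of any
-- type R) are linearly independent as soon as each column a has a pivot row
-- with a nonzero entry, and every other column with a nonzero entry in that
-- row precedes a in some well-founded order: then the coefficient of a is
-- forced to vanish after those of all earlier columns.
triangular⇒independent :
  ∀ {r p} {R : Set} (M : R → Fin r → ℚ) (_≺_ : Rel (Fin r) p) → WellFounded _≺_ →
  (pivot : Fin r → R) →
  (∀ a → M (pivot a) a ≢ 0ℚ) →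
  (∀ a b → b ≢ a → M (pivot a) b ≢ 0ℚ → b ≺ a) →
  (c : Fin r → ℚ) → (∀ ρ → Σℚ (λ i → c i * M ρ i) ≡ 0ℚ) →
  ∀ a → c a ≡ 0ℚ
triangular⇒independent {r} M _≺_ wf pivot pivot≢0 offPivot c combination a =
  coefficient-zero a (wf a)
  where
  coefficient-zero : ∀ a → Acc _≺_ a → c a ≡ 0ℚ
  coefficient-zero a (acc earlier) =
    *-zero-cancelʳ (c a) (M (pivot a) a) (pivot≢0 a)
      (trans (sym (Σℚ-single term a others-vanish)) (combination (pivot a)))
    where
    term : Fin r → ℚ
    term b = c b * M (pivot a) b

    others-vanish : ∀ b → b ≢ a → term b ≡ 0ℚ
    others-vanish b b≢a with M (pivot a) b ℚ.≟ 0ℚ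
    ... | yes entry≡0 = trans (cong (c b *_) entry≡0) (ℚP.*-zeroʳ (c b))
    ... | no  entry≢0 =
      trans (cong (_* M (pivot a) b)
                  (coefficient-zero b (earlier (offPivot a b b≢a entry≢0))))
            (ℚP.*-zeroˡ (M (pivot a) b))

allOrSome : ∀ {m} {P Q : Fin m → Set} → (∀ y → P y ⊎ Q y) → (∀ y → P y) ⊎ ∃ Q
allOrSome {zero}  choice = inj₁ (λ ())
allOrSome {suc m} choice with choice F.zero | allOrSome (λ y → choice (F.suc y))
... | inj₂ q₀ | _             = inj₂ (F.zero , q₀)
... | inj₁ _  | inj₂ (y , qy) = inj₂ (F.suc y , qy)
... | inj₁ p₀ | inj₁ ps       = inj₁ λ { F.zero → p₀ ; (F.suc y) → ps y }

module _ {n} {R : Rel (Fin n) 0ℓ} (R? : Decidable R) where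

  data Walk : ℕ → Fin n → Set where
    stop : ∀ {v} → Walk 0 v
    step : ∀ {j v w} → R v w → Walk j w → Walk (suc j) v

  nodeAt : ∀ {j v} → Walk j v → Fin (suc j) → Fin n
  nodeAt {v = v} _          F.zero    = v
  nodeAt         (step _ w) (F.suc i) = nodeAt w i

  fromStart : ∀ {j v} (w : Walk j v) (i : Fin j) → TransClosure R v (nodeAt w (F.suc i))
  fromStart (step r w) F.zero    = [ r ]
  fromStart (step r w) (F.suc i) = r ∷ fromStart w i

  walk-reaches : ∀ {j v} (w : Walk j v) i i′ → i <ᶠ i′ →
                 TransClosure R (nodeAt w i) (nodeAt w i′)
  walk-reaches w          F.zero    (F.suc i′) _         = fromStart w i′
  walk-reaches (step _ w) (F.suc i) (F.suc i′) (s≤s i<i′) = walk-reaches w i i′ i<i′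

  accessibleOrWalk : ∀ j v → Acc (flip R) v ⊎ Walk j v
  accessibleOrWalk zero    v = inj₂ stop
  accessibleOrWalk (suc j) v with allOrSome successor
    where
    successor : ∀ y → (R v y → Acc (flip R) y) ⊎ (R v y × Walk j y)
    successor y with R? v y | accessibleOrWalk j y
    ... | no ¬r | _        = inj₁ (λ r → ⊥-elim (¬r r))
    ... | yes _ | inj₁ a   = inj₁ (λ _ → a)
    ... | yes r | inj₂ w   = inj₂ (r , w)
  ... | inj₁ accessible    = inj₁ (acc λ {y} r → accessible y r)
  ... | inj₂ (y , r , w)   = inj₂ (step r w)

  -- a walk of n arcs repeats a node, closing a cycle
  acyclic⇒wellFounded : (∀ a → ¬ TransClosure R a a) → WellFounded (flip R)
  acyclic⇒wellFounded acyclic v with accessibleOrWalk n v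
  ... | inj₁ a = a
  ... | inj₂ w with FP.pigeonhole (ℕP.n<1+n n) (nodeAt w)
  ...   | i , i′ , i<i′ , same =
    ⊥-elim (acyclic (nodeAt w i′)
             (subst (λ x → TransClosure R x (nodeAt w i′)) same (walk-reaches w i i′ i<i′)))

lookup-injective : ∀ {X : Set} {xs : List X} → Unique xs →
                   ∀ i j → lookup xs i ≡ lookup xs j → i ≡ j
lookup-injective (_ ∷ _)  F.zero    F.zero    _ = refl
lookup-injective (x∉ ∷ _) F.zero    (F.suc j) e = ⊥-elim (All-lookup x∉ (∈-lookup j) e)
lookup-injective (x∉ ∷ _) (F.suc i) F.zero    e = ⊥-elim (All-lookup x∉ (∈-lookup i) (sym e))
lookup-injective (_ ∷ u)  (F.suc i) (F.suc j) e = cong F.suc (lookup-injective u i j e)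

-- §4  An entry M[{a,b},t] vanishes unless a or b is the vertex moved at t;
-- so the column of a cycle over w is supported on rows at w.
module _ {n k ℓ} (L : Seq n k ℓ) (τ₀ : Config n k) where

  Ment-away : ∀ a b t → a ≢ vtx (L t) → b ≢ vtx (L t) → Ment L τ₀ a b t ≡ + 0
  Ment-away a b t a≢v b≢v with a ≟ vtx (L t)
  ... | yes a≡v = ⊥-elim (a≢v a≡v)
  ... | no _ with b ≟ vtx (L t)
  ...   | yes b≡v = ⊥-elim (b≢v b≡v)
  ...   | no _ = refl

  Pent-away : ∀ a b w ts → All (λ t → vtx (L t) ≡ w) ts → a ≢ w → b ≢ w →
              Pent L τ₀ a b ts ≡ + 0
  Pent-away a b w []       []           a≢w b≢w = refl
  Pent-away a b w (t ∷ ts) (t-at-w ∷ at-w) a≢w b≢w =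
    cong₂ ℤ._+_ (Ment-away a b t (λ e → a≢w (trans e t-at-w)) (λ e → b≢w (trans e t-at-w)))
                (Pent-away a b w ts at-w a≢w b≢w)

  circuit-moves : ∀ {w} ts → IsCircuitOver L w ts → All (λ t → vtx (L t) ≡ w) ts
  circuit-moves (_ ∷ _) (moves , _) = moves

-- §5  Assigning a cycle and a level to every arc, node by node.
module ColumnAssignment {n k ℓ} (L : Seq n k ℓ) (τ₀ : Config n k) (H : DiGraph L) where

  record NeighbourOrdering (v : Fin n) : Set where
    field
      m       : ℕ
      nbr     : Fin m → Fin n
      cyc     : Fin m → CycleOver L v
      covers  : ∀ {x} → Arc H v x → ∃[ i ] nbr i ≡ x
      pivot≢0 : ∀ i → Pent L τ₀ v (nbr i) (proj₁ (cyc i)) ≢ + 0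
      upper≡0 : ∀ i j → i <ᶠ j → Pent L τ₀ v (nbr j) (proj₁ (cyc i)) ≡ + 0
  open NeighbourOrdering

  -- The cycle and level an ordering at v assigns to the pair (v, x):
  -- Cᵢ and m ∸ i when x = uᵢ (levels decrease along the ordering).
  slotBy : ∀ {v} → NeighbourOrdering v → Fin n → List (Fin ℓ) × ℕ
  slotBy o x with FP.any? (λ i → nbr o i ≟ x)
  ... | yes (i , _) = proj₁ (cyc o i) , m o ∸ toℕ i
  ... | no _        = [] , 0

  slotBy-cycle : ∀ {v x} (o : NeighbourOrdering v) → Arc H v x →
                 IsCycleOver L v (proj₁ (slotBy o x))
  slotBy-cycle {x = x} o vx with FP.any? (λ i → nbr o i ≟ x)
  ... | yes (i , _) = proj₂ (cyc o i)
  ... | no none      = ⊥-elim (none (covers o vx))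

  slotBy-pivot : ∀ {v x} (o : NeighbourOrdering v) → Arc H v x →
                 Pent L τ₀ v x (proj₁ (slotBy o x)) ≢ + 0
  slotBy-pivot {x = x} o vx with FP.any? (λ i → nbr o i ≟ x)
  ... | yes (i , refl) = pivot≢0 o i
  ... | no none        = ⊥-elim (none (covers o vx))

  slotBy-triangular : ∀ {v x y} (o : NeighbourOrdering v) → Arc H v x → Arc H v y → x ≢ y →
                      Pent L τ₀ v x (proj₁ (slotBy o y)) ≢ + 0 →
                      proj₂ (slotBy o y) ℕ.< proj₂ (slotBy o x)
  slotBy-triangular {x = x} {y} o vx vy x≢y entry≢0
    with FP.any? (λ i → nbr o i ≟ x) | FP.any? (λ i → nbr o i ≟ y)
  ... | no none | _       = ⊥-elim (none (covers o vx))
  ... | yes _   | no none = ⊥-elim (none (covers o vy))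
  ... | yes (i , refl) | yes (j , refl) with FP.<-cmp i j
  ...   | tri< i<j _ _ = ℕP.∸-monoʳ-< i<j (ℕP.<⇒≤ (FP.toℕ<n j))
  ...   | tri≈ _ i≡j _ = ⊥-elim (x≢y (cong (nbr o) i≡j))
  ...   | tri> _ _ j<i = ⊥-elim (entry≢0 (upper≡0 o j i j<i))

  -- Arcs are compared by tail along H (heads before tails), then by level.
  _◁_ : Rel (Fin n × ℕ) 0ℓ
  _◁_ = ×-Lex _≡_ (flip (Arc H)) ℕ._<_

  module _ (nwi : NeighborWiseIndependent L τ₀ H) where

    ordering : ∀ v → InS L v → NeighbourOrdering v
    ordering v s with nwi v s
    ... | m , u , C , _ , spans , nz , zr = record
      { m = m ; nbr = u ; cyc = C
      ; covers = λ vx → Equivalence.to (spans _) vx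
      ; pivot≢0 = nz ; upper≡0 = zr }

    -- One fixed choice of slots for all pairs of nodes, so that arcs with a
    -- common tail are compared within the same ordering.
    slot : Fin n → Fin n → List (Fin ℓ) × ℕ
    slot v x with FP.any? (λ t → vtx (L t) ≟ v)
    ... | yes s = slotBy (ordering v s) x
    ... | no _  = [] , 0

    cycleOf : Fin n → Fin n → List (Fin ℓ)
    cycleOf v x = proj₁ (slot v x)

    levelOf : Fin n → Fin n → ℕ
    levelOf v x = proj₂ (slot v x)

    cycleOf-isCycle : ∀ {v x} → Arc H v x → IsCycleOver L v (cycleOf v x)
    cycleOf-isCycle {v} vx with FP.any? (λ t → vtx (L t) ≟ v)
    ... | yes s    = slotBy-cycle (ordering v s) vx
    ... | no notIn = ⊥-elim (notIn (proj₁ (inNodes H vx)))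

    cycleOf-pivot : ∀ {v x} → Arc H v x → Pent L τ₀ v x (cycleOf v x) ≢ + 0
    cycleOf-pivot {v} vx with FP.any? (λ t → vtx (L t) ≟ v)
    ... | yes s    = slotBy-pivot (ordering v s) vx
    ... | no notIn = ⊥-elim (notIn (proj₁ (inNodes H vx)))

    levelOf-triangular : ∀ {v x y} → Arc H v x → Arc H v y → x ≢ y →
                         Pent L τ₀ v x (cycleOf v y) ≢ + 0 → levelOf v y ℕ.< levelOf v x
    levelOf-triangular {v} vx vy x≢y with FP.any? (λ t → vtx (L t) ≟ v)
    ... | yes s    = slotBy-triangular (ordering v s) vx vy x≢y
    ... | no notIn = ⊥-elim (notIn (proj₁ (inNodes H vx)))

    -- The column of wy has a nonzero entry in the pivot row {v,x} of another
    -- arc vx only if wy comes before vx: its cycle lives at w, so w ∈ {v, x}.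
    column-before : ∀ {v x w y} → Arc H v x → Arc H w y → (w , y) ≢ (v , x) →
                    Pent L τ₀ v x (cycleOf w y) ≢ + 0 →
                    (w , levelOf w y) ◁ (v , levelOf v x)
    column-before {v} {x} {w} {y} vx wy distinct entry≢0 with w ≟ v | w ≟ x
    ... | yes refl | _ =
      inj₂ (refl , levelOf-triangular vx wy (λ x≡y → distinct (cong (v ,_) (sym x≡y))) entry≢0)
    ... | no _ | yes refl = inj₁ vx
    ... | no w≢v | no w≢x =
      ⊥-elim (entry≢0 (Pent-away L τ₀ v x w (cycleOf w y)
                        (circuit-moves L τ₀ (cycleOf w y) (proj₁ (cycleOf-isCycle wy)))
                        (λ v≡w → w≢v (sym v≡w)) (λ x≡w → w≢x (sym x≡w))))

-- §6  The arcs of H, enumerated as positions of its arc list, and their columns.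
module ArcColumns {n k ℓ} (G : Graph n) (L : Seq n k ℓ) (τ₀ : Config n k) (H : DiGraph L)
                  (good : Good G L τ₀ H) (nwi : NeighborWiseIndependent L τ₀ H) where
  open ColumnAssignment L τ₀ H
  open DecMembership (≡-dec (_≟_ {n}) (_≟_ {n})) using (_∈?_)

  tail head : Fin (size H) → Fin n
  tail a = proj₁ (lookup (arcs H) a)
  head a = proj₂ (lookup (arcs H) a)

  isArc : ∀ a → Arc H (tail a) (head a)
  isArc = ∈-lookup

  column : Fin (size H) → Cycle L
  column a = cycleOf nwi (tail a) (head a) , tail a , cycleOf-isCycle nwi (isArc a)

  Edge : Set
  Edge = Σ (Fin n) λ x → Σ (Fin n) λ y → Graph.Adj G x y

  entry : Edge → Fin (size H) → ℚ
  entry (x , y , _) b = toℚ (Pent L τ₀ x y (proj₁ (column b)))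

  pivotRow : Fin (size H) → Edge
  pivotRow a = tail a , head a , proj₁ (proj₂ (proj₂ (good (isArc a))))

  pivot≢0 : ∀ a → entry (pivotRow a) a ≢ 0ℚ
  pivot≢0 a e = cycleOf-pivot nwi (isArc a) (toℚ-injective-zero _ e)

  key : Fin (size H) → Fin n × ℕ
  key a = tail a , levelOf nwi (tail a) (head a)

  _≺_ : Rel (Fin (size H)) 0ℓ
  _≺_ = _◁_ on key

  ≺-wellFounded : Acyclic H → WellFounded _≺_
  ≺-wellFounded acyclic =
    On.wellFounded key (×-wellFounded (acyclic⇒wellFounded (λ v w → (v , w) ∈? arcs H) acyclic)
                                    <-wellFounded)

  offPivot : ∀ a b → b ≢ a → entry (pivotRow a) b ≢ 0ℚ → b ≺ a
  offPivot a b b≢a entry≢0 =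
    column-before nwi (isArc a) (isArc b)
      (λ same → b≢a (lookup-injective (unique H) b a same))
      (λ pent≡0 → entry≢0 (cong toℚ pent≡0))

-- The columns indexed by the arcs of H are triangular with respect to the
-- well-founded order ≺ (§5, §6), hence independent (§2).
lemma4p11 : ∀ {n k ℓ} → 2 ≤ k → (G : Graph n) (L : Seq n k ℓ) (τ₀ : Config n k) →
    Valid L τ₀ →
    (H : DiGraph L) → Acyclic H → Good G L τ₀ H → NeighborWiseIndependent L τ₀ H →
    RankAtLeast G L τ₀ (size H)
lemma4p11 _ G L τ₀ _ H acyclic good nwi =
  column , λ c combination →
    triangular⇒independent entry _≺_ (≺-wellFounded acyclic) pivotRow pivot≢0 offPivot c
      (λ { (x , y , xy) → combination x y xy })
  where open ArcColumns G L τ₀ H good nwi
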